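{- Let $\mathbf G$ be a finite abelian group, $N=|\mathbf G|$, $m,n$ positive integers, and $A,B\subseteq\mathbf G$. Then $$\mathcal U_{nm}(A+B)\geqslant\mathcal U_m(A)\,\mathcal U_n(B)^m.$$ In particular, for any $S\subseteq\mathbf G$, $$|A+B+S|\geqslant\left(\frac{|S|}{N}\right)^{1/(mn)}\overline{\mathcal U}_m(A)^{1/n}\,\overline{\mathcal U}_n(B)\,N,$$ and, if $m\geqslant2$, for every positive integer $l$, $$\overline{\mathcal U}_{m^l}(lA)\geqslant\overline{\mathcal U}_m(A)^{\frac{m^l-1}{m^l-m^{l-1}}}.$$
   Context: For $A\subseteq\mathbf G$ and a positive integer $n$, $A^n-\Delta_n(\mathbf G)=\{(a_1-g,\dots,a_n-g):a_i\in A,\ g\in\mathbf G\}\subseteq\mathbf G^n$, $\mathcal U_n(A)=|A^n-\Delta_n(\mathbf G)|/N^n$ and $\overline{\mathcal U}_n(A)=\mathcal U_n(A)^{1/n}$. $lA=A+\dots+A$ ($l$ times). -}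

module Defs where

open import Level using (0ℓ)
open import Data.Nat using (ℕ; zero; suc)
open import Data.Fin using (Fin)
open import Data.Fin.Subset using (Subset; _∈_; ⁅_⁆)
open import Data.Fin.Subset.Properties using (_∈?_)
open import Data.Fin.Properties using (any?; _≟_)
open import Data.Vec using (Vec; []; _∷_; tabulate)
open import Data.Vec.Relation.Unary.All using (All; all?)
open import Data.List using (List; []; _∷_; concatMap; map; length; filter; allFin)
open import Data.Product using (∃; ∃-syntax; _×_; _,_)
open import Relation.Nullary using (Dec; does)
open import Relation.Nullary.Decidable using (_×-dec_)
open import Relation.Binary.PropositionalEquality using (_≡_)
open import Algebra.Core using (Op₁; Op₂)
open import Algebra.Structures using (IsAbelianGroup)

-- A finite abelian group of order N, with carrier Fin N (every finite abelian
-- group of order N is isomorphic to one of this form).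
record FinAbGroup (N : ℕ) : Set where
  infixl 6 _+_
  field
    _+_            : Op₂ (Fin N)
    0g             : Fin N
    -_             : Op₁ (Fin N)
    isAbelianGroup : IsAbelianGroup _≡_ _+_ 0g -_

allTuples : {N : ℕ} (n : ℕ) → List (Vec (Fin N) n)
allTuples zero    = [] ∷ []
allTuples {N} (suc n) = concatMap (λ x → map (x ∷_) (allTuples n)) (allFin N)

module Ops {N : ℕ} (G : FinAbGroup N) where
  open FinAbGroup G

  InSum : Subset N → Subset N → Fin N → Set
  InSum A B x = ∃[ a ] ∃[ b ] (a ∈ A × b ∈ B × a + b ≡ x)

  InSum? : (A B : Subset N) (x : Fin N) → Dec (InSum A B x)
  InSum? A B x = any? λ a → any? λ b → (a ∈? A) ×-dec ((b ∈? B) ×-dec (a + b ≟ x))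

  infixl 6 _⊕_
  _⊕_ : Subset N → Subset N → Subset N
  A ⊕ B = tabulate λ x → does (InSum? A B x)

  _·_ : ℕ → Subset N → Subset N
  zero  · A = ⁅ 0g ⁆
  suc l · A = A ⊕ (l · A)

  -- x ∈ A^n − Δ_n(G)  iff  ∃ g, x_i + g ∈ A for all i  (i.e. x_i = a_i − g)
  InDiag : (n : ℕ) → Subset N → Vec (Fin N) n → Set
  InDiag n A x = ∃[ g ] All (λ xi → xi + g ∈ A) x

  InDiag? : (n : ℕ) (A : Subset N) (x : Vec (Fin N) n) → Dec (InDiag n A x)
  InDiag? n A x = any? λ g → all? (λ xi → xi + g ∈? A) x

  -- |A^n − Δ_n(G)|  (so that U_n(A) = Ucard n A / N^n)
  Ucard : ℕ → Subset N → ℕ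
  Ucard n A = length (filter (InDiag? n A) (allTuples n))

-- Both sumset inequalities come from one injection. Choose for each x ∈ B^n − Δ a
-- translate h(x) with x + h(x) ∈ B^n; then (a, x) ↦ (x + h(x) + a, x₁) is injective,
-- since x₁ recovers the common translate t = h(x) + a, then x, then a. Applied to
-- the m columns of a matrix it maps (A^m − Δ) × (B^n − Δ)^m into
-- ((A + B)^{mn} − Δ) × G^m: if a + g ∈ A^m, every entry of column j moved by g is
-- (a_j + g) + (x_{j,i} + h(x_j)) ∈ A + B. The same map sends (C^k − Δ) × S into
-- (C + S)^k × G. For lA one inducts on l, starting from U_1({0}) = 1 and using the
-- first inequality with B = (l − 1)A, n = m^{l−1}, after raising the induction
-- hypothesis to the m-th power.
module Submission where

open import Defs
open import Data.Nat using (ℕ; zero; suc; _*_; _+_; _^_; _∸_; _≤_; _≥_)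
open import Data.Nat.Properties
open import Data.Nat.Tactic.RingSolver using (solve-∀)
open import Data.Fin using (Fin; zero; suc)
import Data.Fin.Properties as Fin
open import Data.Fin.Subset using (Subset; ∣_∣; inside; outside; _∈_; ⁅_⁆)
open import Data.Fin.Subset.Properties using (_∈?_; x∈⁅x⁆)
open import Data.Vec as Vec using (Vec; []; _∷_; _++_; head)
open import Data.Vec.Properties using (++-injective; ∷-injective; ∷-injectiveˡ; ∷-injectiveʳ; lookup⇒[]=; lookup∘tabulate)
open import Data.Vec.Relation.Unary.All as All using (All; []; _∷_)
open import Data.Vec.Relation.Unary.All.Properties using (++⁺; map⁺)
open import Data.List as List using (List; []; _∷_; length; map; filter; allFin; cartesianProductWith; cartesianProduct; concatMap; lookup; tabulate)
open import Data.List.Properties using (length-++; length-map; map-tabulate; length-tabulate; filter-all)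
open import Data.List.Relation.Unary.Any using (index; here)
import Data.List.Relation.Unary.All as ListAll
open import Data.List.Relation.Unary.AllPairs using ([]; _∷_)
open import Data.List.Relation.Unary.Unique.Propositional using (Unique)
open import Data.List.Relation.Unary.Unique.Propositional.Properties using (cartesianProductWith⁺; cartesianProduct⁺; allFin⁺; filter⁺)
open import Data.List.Membership.Propositional using () renaming (_∈_ to _∈ₗ_)
open import Data.List.Membership.Propositional.Properties
  using (∈-lookup; ∈-cartesianProductWith⁺; ∈-cartesianProductWith⁻; ∈-cartesianProduct⁺; ∈-cartesianProduct⁻; ∈-allFin; ∈-filter⁺; ∈-filter⁻)
open import Data.List.Membership.Setoid.Properties using (index-injective)
open import Data.Product using (_×_; _,_; proj₁; proj₂)
open import Data.Empty using (⊥-elim)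
open import Function using (Injective; id)
open import Relation.Nullary using (yes; no; does)
open import Relation.Nullary.Decidable using (dec-true)
open import Relation.Binary.PropositionalEquality
open import Algebra.Bundles using (AbelianGroup)
open import Algebra.Structures using (IsAbelianGroup)
import Algebra.Properties.AbelianGroup as AbelianGroupProperties
open import Level using (0ℓ)

module _ {X : Set} where

  lookup-injective : ∀ {xs : List X} → Unique xs → Injective _≡_ _≡_ (lookup xs)
  lookup-injective {_ ∷ _} (_    ∷ _)    {zero}  {zero}  _  = refl
  lookup-injective {_ ∷ _} (x≢xs ∷ _)    {zero}  {suc j} eq = ⊥-elim (ListAll.lookup x≢xs (∈-lookup j) eq)
  lookup-injective {_ ∷ _} (x≢xs ∷ _)    {suc i} {zero}  eq = ⊥-elim (ListAll.lookup x≢xs (∈-lookup i) (sym eq))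
  lookup-injective {_ ∷ _} (_    ∷ uniq) {suc i} {suc j} eq = cong suc (lookup-injective uniq eq)

  injective⇒length≤ : ∀ {Y : Set} {xs : List X} {ys : List Y} (f : X → Y) → Injective _≡_ _≡_ f →
                      Unique xs → (∀ {x} → x ∈ₗ xs → f x ∈ₗ ys) → length xs ≤ length ys
  injective⇒length≤ {Y} {xs} {ys} f f-injective uniq f∈ys = Fin.injective⇒≤ position-injective
    where
    position : Fin (length xs) → Fin (length ys)
    position i = index (f∈ys (∈-lookup i))

    position-injective : Injective _≡_ _≡_ position
    position-injective eq =
      lookup-injective uniq (f-injective (index-injective (setoid Y) (f∈ys (∈-lookup _)) (f∈ys (∈-lookup _)) eq))

length-cartesianProductWith : ∀ {X Y Z : Set} (f : X → Y → Z) xs ys →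
                              length (cartesianProductWith f xs ys) ≡ length xs * length ys
length-cartesianProductWith f []       ys = refl
length-cartesianProductWith f (x ∷ xs) ys = begin
  length (map (f x) ys List.++ cartesianProductWith f xs ys)     ≡⟨ length-++ (map (f x) ys) ⟩
  length (map (f x) ys) + length (cartesianProductWith f xs ys)  ≡⟨ cong₂ _+_ (length-map (f x) ys) (length-cartesianProductWith f xs ys) ⟩
  length ys + length xs * length ys                              ∎
  where open ≡-Reasoning

module _ {X : Set} where

  allVecs : List X → (k : ℕ) → List (Vec X k)
  allVecs xs zero    = [] ∷ []
  allVecs xs (suc k) = cartesianProductWith _∷_ xs (allVecs xs k)

  length-allVecs : ∀ xs k → length (allVecs xs k) ≡ length xs ^ k
  length-allVecs xs zero    = refl
  length-allVecs xs (suc k) =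
    trans (length-cartesianProductWith _∷_ xs (allVecs xs k)) (cong (length xs *_) (length-allVecs xs k))

  allVecs⁺ : ∀ {xs} → Unique xs → ∀ k → Unique (allVecs xs k)
  allVecs⁺ uniq zero    = ListAll.[] ∷ []
  allVecs⁺ uniq (suc k) = cartesianProductWith⁺ _∷_ ∷-injective uniq (allVecs⁺ uniq k)

  ∈-allVecs⁺ : ∀ {xs k} {v : Vec X k} → All (_∈ₗ xs) v → v ∈ₗ allVecs xs k
  ∈-allVecs⁺ []         = here refl
  ∈-allVecs⁺ (x∈xs ∷ v∈) = ∈-cartesianProductWith⁺ _∷_ x∈xs (∈-allVecs⁺ v∈)

  ∈-allVecs⁻ : ∀ {xs} k {v : Vec X k} → v ∈ₗ allVecs xs k → All (_∈ₗ xs) v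
  ∈-allVecs⁻ zero    {[]} _ = []
  ∈-allVecs⁻ {xs} (suc k) v∈ with ∈-cartesianProductWith⁻ _∷_ xs (allVecs xs k) v∈
  ... | _ , _ , x∈xs , w∈ , refl = x∈xs ∷ ∈-allVecs⁻ k w∈

concatMap-map≡cartesianProductWith : ∀ {X Y Z : Set} (f : X → Y → Z) xs ys →
                                     concatMap (λ x → map (f x) ys) xs ≡ cartesianProductWith f xs ys
concatMap-map≡cartesianProductWith f []       ys = refl
concatMap-map≡cartesianProductWith f (x ∷ xs) ys = cong (map (f x) ys List.++_) (concatMap-map≡cartesianProductWith f xs ys)

module _ {N : ℕ} where

  allTuples≡allVecs : ∀ k → allTuples {N} k ≡ allVecs (allFin N) k
  allTuples≡allVecs zero    = refl
  allTuples≡allVecs (suc k) = begin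
    concatMap (λ x → map (x ∷_) (allTuples k)) (allFin N)          ≡⟨ cong (λ T → concatMap (λ x → map (x ∷_) T) (allFin N)) (allTuples≡allVecs k) ⟩
    concatMap (λ x → map (x ∷_) (allVecs (allFin N) k)) (allFin N) ≡⟨ concatMap-map≡cartesianProductWith _∷_ (allFin N) _ ⟩
    allVecs (allFin N) (suc k)                                     ∎
    where open ≡-Reasoning

  length-allTuples : ∀ k → length (allTuples {N} k) ≡ N ^ k
  length-allTuples k rewrite allTuples≡allVecs k | length-allVecs (allFin N) k | length-tabulate {n = N} id = refl

  allTuples⁺ : ∀ k → Unique (allTuples {N} k)
  allTuples⁺ k rewrite allTuples≡allVecs k = allVecs⁺ (allFin⁺ N) k

  ∈-allTuples : ∀ {k} (v : Vec (Fin N) k) → v ∈ₗ allTuples k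
  ∈-allTuples {k} v rewrite allTuples≡allVecs k = ∈-allVecs⁺ (All.universal ∈-allFin v)

length-filter-∈?-suc : ∀ {n} b (p : Subset n) →
                       length (filter (_∈? b ∷ p) (tabulate suc)) ≡ length (filter (_∈? p) (allFin n))
length-filter-∈?-suc b p = trans (cong (λ ys → length (filter (_∈? b ∷ p) ys)) (sym (map-tabulate id suc)))
                                 (length-filter-map-suc (allFin _))
  where
  length-filter-map-suc : ∀ xs → length (filter (_∈? b ∷ p) (map suc xs)) ≡ length (filter (_∈? p) xs)
  length-filter-map-suc []       = refl
  length-filter-map-suc (x ∷ xs) with x ∈? p
  ... | yes _ = cong suc (length-filter-map-suc xs)
  ... | no  _ = length-filter-map-suc xs

∣p∣≡length-filter : ∀ {n} (p : Subset n) → ∣ p ∣ ≡ length (filter (_∈? p) (allFin n))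
∣p∣≡length-filter []            = refl
∣p∣≡length-filter (inside  ∷ p) = cong suc (trans (∣p∣≡length-filter p) (sym (length-filter-∈?-suc inside p)))
∣p∣≡length-filter (outside ∷ p) = trans (∣p∣≡length-filter p) (sym (length-filter-∈?-suc outside p))

map-injective : ∀ {X Y : Set} {f : X → Y} → Injective _≡_ _≡_ f → ∀ {n} → Injective _≡_ _≡_ (Vec.map {n = n} f)
map-injective f-injective {_} {[]}     {[]}     _  = refl
map-injective f-injective {_} {x ∷ xs} {y ∷ ys} eq =
  cong₂ _∷_ (f-injective (∷-injectiveˡ eq)) (map-injective f-injective (∷-injectiveʳ eq))

module _ {X Y Z W : Set} {k : ℕ} (f : X × Y → Vec Z k × W) where

  stack : ∀ {m} → Vec X m × Vec Y m → Vec Z (m * k) × Vec W m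
  stack ([]     , [])     = [] , []
  stack (x ∷ xs , y ∷ ys) = let (c , w) = f (x , y); (cs , ws) = stack (xs , ys) in c ++ cs , w ∷ ws

  stack-injective : Injective _≡_ _≡_ f → ∀ {m} → Injective _≡_ _≡_ (stack {m})
  stack-injective f-injective {_} {[]     , []}     {[]       , []}       _  = refl
  stack-injective f-injective {_} {x ∷ xs , y ∷ ys} {x′ ∷ xs′ , y′ ∷ ys′} eq
    with c≡c′ , cs≡cs′ ← ++-injective _ _ (cong proj₁ eq)
       | w≡w′ , ws≡ws′ ← ∷-injective (cong proj₂ eq)
    with refl ← f-injective (cong₂ _,_ c≡c′ w≡w′)
       | refl ← stack-injective f-injective {_} {xs , ys} {xs′ , ys′} (cong₂ _,_ cs≡cs′ ws≡ws′)
    = refl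

  stack-All : ∀ {P : X → Set} {Q : Y → Set} {R : Z → Set} →
              (∀ {x y} → P x → Q y → All R (proj₁ (f (x , y)))) →
              ∀ {m} {xs : Vec X m} {ys} → All P xs → All Q ys → All R (proj₁ (stack (xs , ys)))
  stack-All R-f []         []         = []
  stack-All R-f (px ∷ pxs) (qy ∷ qys) = ++⁺ (R-f px qy) (stack-All R-f pxs qys)

^-distrib-* : ∀ x y n → (x * y) ^ n ≡ x ^ n * y ^ n
^-distrib-* x y zero    = refl
^-distrib-* x y (suc n) = trans (cong (x * y *_) (^-distrib-* x y n)) (interchange x y (x ^ n) (y ^ n))
  where
  interchange : ∀ a b c d → a * b * (c * d) ≡ a * c * (b * d)
  interchange = solve-∀

-- With m = q + 1 and a, X, Y standing for Ucard m A, Ucard E (lA), Ucard (mE) ((l+1)A), the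
-- first hypothesis is U_E(lA)^{m−1} ≥ U_m(A)^{E−1} with denominators cleared, the second is
-- the sumset inequality, and the conclusion is the first one for (l+1)A.
iterate-step : ∀ q {E a N X Y} → 1 ≤ E →
               a ^ (E ∸ 1) * N ^ (E * q) ≤ X ^ q * N ^ (suc q * (E ∸ 1)) →
               a * X ^ suc q ≤ Y * N ^ suc q →
               a ^ (suc q * E ∸ 1) * N ^ (suc q * E * q) ≤ Y ^ q * N ^ (suc q * (suc q * E ∸ 1))
iterate-step q {suc e} {a} {N} {X} {Y} _ ih step = begin
    a ^ (e + q * E) * N ^ (m * E * q)     ≡⟨ split ⟩
    a ^ q * (a ^ e * N ^ (E * q)) ^ m    ≤⟨ *-monoʳ-≤ (a ^ q) (^-monoˡ-≤ m ih) ⟩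
    a ^ q * (X ^ q * N ^ (m * e)) ^ m    ≡⟨ regroup ⟩
    (a * X ^ m) ^ q * N ^ (m * e * m)    ≤⟨ *-monoˡ-≤ (N ^ (m * e * m)) (^-monoˡ-≤ q step) ⟩
    (Y * N ^ m) ^ q * N ^ (m * e * m)    ≡⟨ merge ⟩
    Y ^ q * N ^ (m * (e + q * E))        ∎
  where
  open ≤-Reasoning
  m E : ℕ
  m = suc q
  E = suc e

  split : a ^ (e + q * E) * N ^ (m * E * q) ≡ a ^ q * (a ^ e * N ^ (E * q)) ^ m
  split = begin-equality
    a ^ (e + q * E) * N ^ (m * E * q)          ≡⟨ cong₂ (λ i j → a ^ i * N ^ j) (lhs-exponent₁ q e) (lhs-exponent₂ q e) ⟩
    a ^ (q + e * m) * N ^ (E * q * m)          ≡⟨ cong (_* N ^ (E * q * m)) (^-distribˡ-+-* a q (e * m)) ⟩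
    a ^ q * a ^ (e * m) * N ^ (E * q * m)      ≡⟨ *-assoc (a ^ q) _ _ ⟩
    a ^ q * (a ^ (e * m) * N ^ (E * q * m))    ≡⟨ cong (a ^ q *_) (cong₂ _*_ (^-*-assoc a e m) (^-*-assoc N (E * q) m)) ⟨
    a ^ q * ((a ^ e) ^ m * (N ^ (E * q)) ^ m)  ≡⟨ cong (a ^ q *_) (^-distrib-* (a ^ e) (N ^ (E * q)) m) ⟨
    a ^ q * (a ^ e * N ^ (E * q)) ^ m          ∎
    where
    lhs-exponent₁ : ∀ q e → e + q * suc e ≡ q + e * suc q
    lhs-exponent₁ = solve-∀
    lhs-exponent₂ : ∀ q e → suc q * suc e * q ≡ suc e * q * suc q
    lhs-exponent₂ = solve-∀

  regroup : a ^ q * (X ^ q * N ^ (m * e)) ^ m ≡ (a * X ^ m) ^ q * N ^ (m * e * m)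
  regroup = begin-equality
    a ^ q * (X ^ q * N ^ (m * e)) ^ m          ≡⟨ cong (a ^ q *_) (^-distrib-* (X ^ q) (N ^ (m * e)) m) ⟩
    a ^ q * ((X ^ q) ^ m * (N ^ (m * e)) ^ m)  ≡⟨ cong (λ x → a ^ q * (x * (N ^ (m * e)) ^ m)) X^q^m≡X^m^q ⟩
    a ^ q * ((X ^ m) ^ q * (N ^ (m * e)) ^ m)  ≡⟨ *-assoc (a ^ q) _ _ ⟨
    a ^ q * (X ^ m) ^ q * (N ^ (m * e)) ^ m    ≡⟨ cong₂ _*_ (sym (^-distrib-* a (X ^ m) q)) (^-*-assoc N (m * e) m) ⟩
    (a * X ^ m) ^ q * N ^ (m * e * m)          ∎
    where
    X^q^m≡X^m^q : (X ^ q) ^ m ≡ (X ^ m) ^ q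
    X^q^m≡X^m^q = trans (^-*-assoc X q m) (trans (cong (X ^_) (*-comm q m)) (sym (^-*-assoc X m q)))

  merge : (Y * N ^ m) ^ q * N ^ (m * e * m) ≡ Y ^ q * N ^ (m * (e + q * E))
  merge = begin-equality
    (Y * N ^ m) ^ q * N ^ (m * e * m)        ≡⟨ cong (_* N ^ (m * e * m)) (^-distrib-* Y (N ^ m) q) ⟩
    Y ^ q * (N ^ m) ^ q * N ^ (m * e * m)    ≡⟨ *-assoc (Y ^ q) _ _ ⟩
    Y ^ q * ((N ^ m) ^ q * N ^ (m * e * m))  ≡⟨ cong (λ x → Y ^ q * (x * N ^ (m * e * m))) (^-*-assoc N m q) ⟩
    Y ^ q * (N ^ (m * q) * N ^ (m * e * m))  ≡⟨ cong (Y ^ q *_) (^-distribˡ-+-* N (m * q) (m * e * m)) ⟨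
    Y ^ q * N ^ (m * q + m * e * m)          ≡⟨ cong (λ i → Y ^ q * N ^ i) (rhs-exponent q e) ⟩
    Y ^ q * N ^ (m * (e + q * E))            ∎
    where
    rhs-exponent : ∀ q e → suc q * q + suc q * e * suc q ≡ suc q * (e + q * suc e)
    rhs-exponent = solve-∀

module Sumsets {N : ℕ} (G : FinAbGroup N) where
  open FinAbGroup G renaming (_+_ to _∙_)
  open IsAbelianGroup isAbelianGroup using (assoc; comm)
  open Ops G

  abelianGroup : AbelianGroup 0ℓ 0ℓ
  abelianGroup = record { isAbelianGroup = isAbelianGroup }

  open AbelianGroupProperties abelianGroup using (∙-cancelˡ; ∙-cancelʳ; \\-leftDividesˡ)

  xy∙zw≡[z∙wx]∙y : ∀ x y z w → (x ∙ y) ∙ (z ∙ w) ≡ (z ∙ (w ∙ x)) ∙ y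
  xy∙zw≡[z∙wx]∙y x y z w = begin
    (x ∙ y) ∙ (z ∙ w)  ≡⟨ comm (x ∙ y) (z ∙ w) ⟩
    (z ∙ w) ∙ (x ∙ y)  ≡⟨ assoc (z ∙ w) x y ⟨
    ((z ∙ w) ∙ x) ∙ y  ≡⟨ cong (_∙ y) (assoc z w x) ⟩
    (z ∙ (w ∙ x)) ∙ y  ∎
    where open ≡-Reasoning

  InSum⇒∈⊕ : ∀ {A B x} → InSum A B x → x ∈ A ⊕ B
  InSum⇒∈⊕ {A} {B} {x} x∈A+B =
    lookup⇒[]= x _ (trans (lookup∘tabulate (λ y → does (InSum? A B y)) x) (dec-true (InSum? A B x) x∈A+B))

  -- A translate of x into A^n chosen as a function of x (junk value 0g when x ∉ A^n − Δ).
  shift : ∀ {n} → Subset N → Vec (Fin N) n → Fin N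
  shift {n} A x with InDiag? n A x
  ... | yes (g , _) = g
  ... | no  _       = 0g

  shift-correct : ∀ {n A} {x : Vec (Fin N) n} → InDiag n A x → All (λ xi → xi ∙ shift A x ∈ A) x
  shift-correct {n} {A} {x} x∈A-Δ with InDiag? n A x
  ... | yes (_ , x+g∈A) = x+g∈A
  ... | no  x∉A-Δ       = ⊥-elim (x∉A-Δ x∈A-Δ)

  Ulist : (n : ℕ) → Subset N → List (Vec (Fin N) n)
  Ulist n A = filter (InDiag? n A) (allTuples n)

  Ulist⁺ : ∀ n A → Unique (Ulist n A)
  Ulist⁺ n A = filter⁺ (InDiag? n A) (allTuples⁺ n)

  ∈-Ulist⁺ : ∀ {n A} {x : Vec (Fin N) n} → InDiag n A x → x ∈ₗ Ulist n A
  ∈-Ulist⁺ {n} {A} {x} = ∈-filter⁺ (InDiag? n A) (∈-allTuples x)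

  ∈-Ulist⁻ : ∀ {n A} {x : Vec (Fin N) n} → x ∈ₗ Ulist n A → InDiag n A x
  ∈-Ulist⁻ {n} {A} x∈ = proj₂ (∈-filter⁻ (InDiag? n A) {xs = allTuples n} x∈)

  elements : Subset N → List (Fin N)
  elements S = filter (_∈? S) (allFin N)

  ∈-elements⁺ : ∀ {S x} → x ∈ S → x ∈ₗ elements S
  ∈-elements⁺ {S} {x} = ∈-filter⁺ (_∈? S) (∈-allFin x)

  ∈-elements⁻ : ∀ {S x} → x ∈ₗ elements S → x ∈ S
  ∈-elements⁻ {S} x∈ = proj₂ (∈-filter⁻ (_∈? S) {xs = allFin N} x∈)

  module _ {k : ℕ} (h : Vec (Fin N) (suc k) → Fin N) where

    spread : Fin N × Vec (Fin N) (suc k) → Vec (Fin N) (suc k) × Fin N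
    spread (s , x) = Vec.map (_∙ (h x ∙ s)) x , head x

    spread-injective : Injective _≡_ _≡_ spread
    spread-injective {s , x ∷ xs} {s′ , x′ ∷ xs′} eq
      with refl ← cong proj₂ eq
      with t≡t′ ← ∙-cancelˡ x _ _ (∷-injectiveˡ (cong proj₁ eq))
      with refl ← map-injective (∙-cancelʳ _ _ _)
                    (trans (∷-injectiveʳ (cong proj₁ eq)) (cong (λ t → Vec.map (_∙ t) xs′) (sym t≡t′)))
      with refl ← ∙-cancelˡ (h (x ∷ xs)) s s′ t≡t′
      = refl

  Ucard-⊕ : ∀ m {n} → 1 ≤ n → (A B : Subset N) → Ucard m A * Ucard n B ^ m ≤ Ucard (m * n) (A ⊕ B) * N ^ m
  Ucard-⊕ m {n@(suc _)} _ A B = begin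
    Ucard m A * Ucard n B ^ m                                         ≡⟨ cong (Ucard m A *_) (length-allVecs (Ulist n B) m) ⟨
    Ucard m A * length (allVecs (Ulist n B) m)                        ≡⟨ length-cartesianProductWith _,_ (Ulist m A) _ ⟨
    length (cartesianProduct (Ulist m A) (allVecs (Ulist n B) m))     ≤⟨ injective⇒length≤ Φ Φ-injective domain-unique Φ-maps-into ⟩
    length (cartesianProduct (Ulist (m * n) (A ⊕ B)) (allTuples m))   ≡⟨ length-cartesianProductWith _,_ (Ulist (m * n) (A ⊕ B)) (allTuples m) ⟩
    Ucard (m * n) (A ⊕ B) * length (allTuples m)                      ≡⟨ cong (Ucard (m * n) (A ⊕ B) *_) (length-allTuples m) ⟩
    Ucard (m * n) (A ⊕ B) * N ^ m                                     ∎
    where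
    open ≤-Reasoning
    Φ : Vec (Fin N) m × Vec (Vec (Fin N) n) m → Vec (Fin N) (m * n) × Vec (Fin N) m
    Φ = stack (spread (shift B))

    Φ-injective : Injective _≡_ _≡_ Φ
    Φ-injective = stack-injective (spread (shift B)) (spread-injective (shift B))

    domain-unique : Unique (cartesianProduct (Ulist m A) (allVecs (Ulist n B) m))
    domain-unique = cartesianProduct⁺ (Ulist⁺ m A) (allVecs⁺ (Ulist⁺ n B) m)

    column-∈ : ∀ g {a z} → a ∙ g ∈ A → InDiag n B z → All (λ y → y ∙ g ∈ A ⊕ B) (proj₁ (spread (shift B) (a , z)))
    column-∈ g a+g∈A z∈B-Δ =
      map⁺ (All.map (λ z+h∈B → InSum⇒∈⊕ (_ , _ , a+g∈A , z+h∈B , xy∙zw≡[z∙wx]∙y _ _ _ _)) (shift-correct z∈B-Δ))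

    Φ-maps-into : ∀ {p} → p ∈ₗ cartesianProduct (Ulist m A) (allVecs (Ulist n B) m) →
                  Φ p ∈ₗ cartesianProduct (Ulist (m * n) (A ⊕ B)) (allTuples m)
    Φ-maps-into {a , zs} p∈
      with a∈ , zs∈ ← ∈-cartesianProduct⁻ _ _ p∈
      with g , a+g∈A ← ∈-Ulist⁻ a∈
      = ∈-cartesianProduct⁺ (∈-Ulist⁺ (g , stack-All _ (column-∈ g) a+g∈A (All.map ∈-Ulist⁻ (∈-allVecs⁻ m zs∈))))
                          (∈-allTuples _)

  ∣⊕∣-Ucard : ∀ {k} → 1 ≤ k → (C S : Subset N) → ∣ S ∣ * Ucard k C ≤ ∣ C ⊕ S ∣ ^ k * N
  ∣⊕∣-Ucard {k@(suc _)} _ C S = begin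
    ∣ S ∣ * Ucard k C                                          ≡⟨ cong (_* Ucard k C) (∣p∣≡length-filter S) ⟩
    length (elements S) * Ucard k C                             ≡⟨ length-cartesianProductWith _,_ (elements S) (Ulist k C) ⟨
    length (cartesianProduct (elements S) (Ulist k C))          ≤⟨ injective⇒length≤ Ψ (spread-injective (shift C)) domain-unique Ψ-maps-into ⟩
    length (cartesianProduct (allVecs (elements (C ⊕ S)) k) (allFin N))
      ≡⟨ length-cartesianProductWith _,_ (allVecs (elements (C ⊕ S)) k) (allFin N) ⟩
    length (allVecs (elements (C ⊕ S)) k) * length (allFin N)
      ≡⟨ cong₂ _*_ (length-allVecs (elements (C ⊕ S)) k) (length-tabulate id) ⟩
    length (elements (C ⊕ S)) ^ k * N                           ≡⟨ cong (λ c → c ^ k * N) (∣p∣≡length-filter (C ⊕ S)) ⟨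
    ∣ C ⊕ S ∣ ^ k * N                                           ∎
    where
    open ≤-Reasoning
    Ψ : Fin N × Vec (Fin N) k → Vec (Fin N) k × Fin N
    Ψ = spread (shift C)

    domain-unique : Unique (cartesianProduct (elements S) (Ulist k C))
    domain-unique = cartesianProduct⁺ (filter⁺ (_∈? S) (allFin⁺ N)) (Ulist⁺ k C)

    Ψ-maps-into : ∀ {p} → p ∈ₗ cartesianProduct (elements S) (Ulist k C) →
                  Ψ p ∈ₗ cartesianProduct (allVecs (elements (C ⊕ S)) k) (allFin N)
    Ψ-maps-into {s , x} p∈ with s∈ , x∈ ← ∈-cartesianProduct⁻ _ _ p∈ =
      ∈-cartesianProduct⁺ (∈-allVecs⁺ (map⁺ (All.map entry-∈ (shift-correct (∈-Ulist⁻ x∈))))) (∈-allFin _)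
      where
      entry-∈ : ∀ {xi} → xi ∙ shift C x ∈ C → xi ∙ (shift C x ∙ s) ∈ₗ elements (C ⊕ S)
      entry-∈ xi+h∈C = ∈-elements⁺ (InSum⇒∈⊕ (_ , s , xi+h∈C , ∈-elements⁻ s∈ , assoc _ _ _))

  Ucard-1 : ∀ {A a} → a ∈ A → Ucard 1 A ≡ N
  Ucard-1 {A} {a} a∈A = begin
    Ucard 1 A                 ≡⟨ cong length (filter-all (InDiag? 1 A) (ListAll.universal every-InDiag (allTuples {N} 1))) ⟩
    length (allTuples {N} 1)  ≡⟨ length-allTuples {N} 1 ⟩
    N ^ 1                     ≡⟨ *-identityʳ N ⟩
    N                         ∎
    where
    open ≡-Reasoning
    every-InDiag : ∀ x → InDiag 1 A x
    every-InDiag (x ∷ []) = (- x) ∙ a , subst (_∈ A) (sym (\\-leftDividesˡ x a)) a∈A ∷ []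

  Ucard-· : ∀ q A l → Ucard (suc q) A ^ (suc q ^ l ∸ 1) * N ^ (suc q ^ l * q)
                        ≤ Ucard (suc q ^ l) (l · A) ^ q * N ^ (suc q * (suc q ^ l ∸ 1))
  Ucard-· q A zero    = ≤-reflexive (begin
    1 * N ^ (1 * q)                      ≡⟨ *-identityˡ (N ^ (1 * q)) ⟩
    N ^ (1 * q)                          ≡⟨ cong (N ^_) (*-identityˡ q) ⟩
    N ^ q                                ≡⟨ *-identityʳ (N ^ q) ⟨
    N ^ q * 1                            ≡⟨ cong₂ (λ U i → U ^ q * N ^ i) (Ucard-1 (x∈⁅x⁆ 0g)) (*-zeroʳ (suc q)) ⟨
    Ucard 1 ⁅ 0g ⁆ ^ q * N ^ (suc q * 0) ∎)
    where open ≡-Reasoning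
  Ucard-· q A (suc l) = iterate-step q 1≤m^l (Ucard-· q A l) (Ucard-⊕ (suc q) 1≤m^l A (l · A))
    where
    1≤m^l : 1 ≤ suc q ^ l
    1≤m^l = m^n>0 (suc q) l

corollary15 : ∀ {N : ℕ} (G : FinAbGroup N) (m n : ℕ) → 1 ≤ m → 1 ≤ n → (A B : Subset N) →
    let open Ops G in
      (Ucard (n * m) (A ⊕ B) * N ^ m ≥ Ucard m A * Ucard n B ^ m)
      × (∀ (S : Subset N) → ∣ A ⊕ B ⊕ S ∣ ^ (m * n) * N ^ (m + 1) ≥ ∣ S ∣ * Ucard m A * Ucard n B ^ m)
      × (2 ≤ m → ∀ (l : ℕ) → 1 ≤ l →
          Ucard (m ^ l) (l · A) ^ (m ∸ 1) * N ^ (m * (m ^ l ∸ 1)) ≥ Ucard m A ^ (m ^ l ∸ 1) * N ^ (m ^ l * (m ∸ 1)))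
-- The hypotheses 2 ≤ m and 1 ≤ l only make the paper's exponent well defined; the
-- cleared-denominator inequality holds for every m ≥ 1 and l ≥ 0.
corollary15 {N} G m@(suc q) n 1≤m 1≤n A B = sumset , sumset-S , λ _ l _ → Ucard-· q A l
  where
  open Ops G
  open Sumsets G

  sumset : Ucard m A * Ucard n B ^ m ≤ Ucard (n * m) (A ⊕ B) * N ^ m
  sumset = subst (λ k → Ucard m A * Ucard n B ^ m ≤ Ucard k (A ⊕ B) * N ^ m) (*-comm m n) (Ucard-⊕ m 1≤n A B)

  sumset-S : ∀ S → ∣ S ∣ * Ucard m A * Ucard n B ^ m ≤ ∣ A ⊕ B ⊕ S ∣ ^ (m * n) * N ^ (m + 1)
  sumset-S S = begin
    ∣ S ∣ * Ucard m A * Ucard n B ^ m          ≡⟨ *-assoc ∣ S ∣ _ _ ⟩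
    ∣ S ∣ * (Ucard m A * Ucard n B ^ m)        ≤⟨ *-monoʳ-≤ ∣ S ∣ (Ucard-⊕ m 1≤n A B) ⟩
    ∣ S ∣ * (Ucard (m * n) (A ⊕ B) * N ^ m)    ≡⟨ *-assoc ∣ S ∣ _ _ ⟨
    ∣ S ∣ * Ucard (m * n) (A ⊕ B) * N ^ m      ≤⟨ *-monoˡ-≤ (N ^ m) (∣⊕∣-Ucard (*-mono-≤ 1≤m 1≤n) (A ⊕ B) S) ⟩
    ∣ A ⊕ B ⊕ S ∣ ^ (m * n) * N * N ^ m        ≡⟨ *-assoc (∣ A ⊕ B ⊕ S ∣ ^ (m * n)) N (N ^ m) ⟩
    ∣ A ⊕ B ⊕ S ∣ ^ (m * n) * N ^ (1 + m)      ≡⟨ cong (λ i → ∣ A ⊕ B ⊕ S ∣ ^ (m * n) * N ^ i) (+-comm 1 m) ⟩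
    ∣ A ⊕ B ⊕ S ∣ ^ (m * n) * N ^ (m + 1)      ∎
    where open ≤-Reasoning
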